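{- Let $\mathcal{L}\subseteq\mathbb{Z}^n$ be a lattice, let $i\in\{1,\dots,n\}$ be such that $\ker(\pi_{\{i\}})\cap\mathcal{L}=\{0\}$, and let $S\subseteq\mathcal{L}^{\{i\}}$. Then $S$ is a $\bar\omega^i$-Gröbner basis of $\mathcal{L}^{\{i\}}$ if and only if $\pi^{ -1}_{\{i\}}(S)$ is a $\bar e^i$-Gröbner basis of $\mathcal{L}$.
   Context: $\pi_{\{i\}}:\mathbb{Z}^n\to\mathbb{Z}^{n-1}$ deletes the $i$-th coordinate, and $\mathcal{L}^{\{i\}}:=\pi_{\{i\}}(\mathcal{L})$ (a lattice in $\mathbb{Z}^{n-1}$). Since $\ker(\pi_{\{i\}})\cap\mathcal{L}=\{0\}$, $\pi_{\{i\}}$ restricts to a bijection $\mathcal{L}\to\mathcal{L}^{\{i\}}$ whose inverse is denoted $\pi^{ -1}_{\{i\}}:\mathcal{L}^{\{i\}}\to\mathcal{L}$; $\omega^i\in\mathbb{Q}^{n-1}$ denotes a vector with $\omega^i u=(\pi^{ -1}_{\{i\}}(u))_i$ for all $u\in\mathcal{L}^{\{i\}}$, and $\bar\omega^i=-\omega^i$. $e^i$ is the $i$-th unit vector and $\bar e^i=-e^i$. For a lattice $\mathcal{M}\subseteq\mathbb{Z}^m$ and $b\in\mathbb{Z}^m$, $\mathcal{F}_{\mathcal{M},b}:=\{x\in\mathbb{N}^m:x\equiv b\pmod{\mathcal{M}}\}$, and for $G\subseteq\mathcal{M}$, $\mathcal{G}(\mathcal{F}_{\mathcal{M},b},G)$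 is the undirected graph on $\mathcal{F}_{\mathcal{M},b}$ with an edge $\{x,y\}$ whenever $x-y\in G$ or $y-x\in G$. For $\varphi\in\mathbb{Q}^m$, a path $(x^0,\dots,x^k)$ is a $\varphi$-reduction path if there is no $j\in\{1,\dots,k-1\}$ with $\varphi x^j>\varphi x^0$ and $\varphi x^j>\varphi x^k$. A set $G\subseteq\mathcal{M}$ is a $\varphi$-Gröbner basis of $\mathcal{M}$ if for all $b\in\mathbb{Z}^m$ and all $x,y\in\mathcal{F}_{\mathcal{M},b}$ there is a $\varphi$-reduction path from $x$ to $y$ in $\mathcal{G}(\mathcal{F}_{\mathcal{M},b},G)$. -}

module Defs where

open import Data.Nat using (ℕ; suc; _<_)
open import Data.Integer as ℤ using (ℤ; +_)
open import Data.Rational as ℚ using (ℚ; _/_; 0ℚ; 1ℚ)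
open import Data.Fin using (Fin; toℕ; zero; suc; fromℕ; inject₁)
open import Data.Fin.Properties using () renaming (_≟_ to _≟ᶠ_)
import Data.Vec
open import Data.Vec using (Vec; []; _∷_; zipWith; replicate; lookup; removeAt; tabulate; foldr)
open import Data.Product using (Σ; ∃; _×_; _,_)
open import Data.Sum using (_⊎_)
open import Relation.Binary.PropositionalEquality using (_≡_)
open import Relation.Nullary using (¬_; yes; no)

ℤ^ : ℕ → Set
ℤ^ m = Vec ℤ m

ℚ^ : ℕ → Set
ℚ^ m = Vec ℚ m

Subset : ℕ → Set₁
Subset m = ℤ^ m → Set

_⊆_ : ∀ {m} → Subset m → Subset m → Set
A ⊆ B = ∀ x → A x → B x

zeroV : ∀ {m} → ℤ^ m
zeroV = replicate _ (+ 0)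

_+ᵛ_ : ∀ {m} → ℤ^ m → ℤ^ m → ℤ^ m
_+ᵛ_ = zipWith ℤ._+_

-ᵛ_ : ∀ {m} → ℤ^ m → ℤ^ m
-ᵛ_ = Data.Vec.map (λ z → ℤ.- z)

_-ᵛ_ : ∀ {m} → ℤ^ m → ℤ^ m → ℤ^ m
x -ᵛ y = zipWith ℤ._-_ x y

record IsLattice {m} (L : Subset m) : Set where
  field
    has-zero : L zeroV
    +-closed : ∀ x y → L x → L y → L (x +ᵛ y)
    neg-closed : ∀ x → L x → L (-ᵛ x)

π : ∀ {m} → Fin (suc m) → ℤ^ (suc m) → ℤ^ m
π i v = removeAt v i

proj : ∀ {m} → Fin (suc m) → Subset (suc m) → Subset m
proj i L u = Σ (ℤ^ _) λ v → L v × π i v ≡ u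

-- preimage of S ⊆ L^{i} under the bijection π_{i} restricted to L,
-- i.e. π^{-1}_{i}(S) = { v ∈ L : π_{i}(v) ∈ S }
preimage : ∀ {m} → Fin (suc m) → Subset (suc m) → Subset m → Subset (suc m)
preimage i L S v = L v × S (π i v)

KerTrivial : ∀ {m} → Fin (suc m) → Subset (suc m) → Set
KerTrivial i L = ∀ v → L v → π i v ≡ zeroV → v ≡ zeroV

toℚ : ℤ → ℚ
toℚ z = z / 1

_·_ : ∀ {m} → ℚ^ m → ℤ^ m → ℚ
φ · x = foldr _ ℚ._+_ 0ℚ (zipWith (λ a b → a ℚ.* toℚ b) φ x)

negQ : ∀ {m} → ℚ^ m → ℚ^ m
negQ = Data.Vec.map (λ q → ℚ.- q)

-- unit vector e^i and ē^i = - e^i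
unitQ : ∀ {m} → Fin m → ℚ^ m
unitQ i = tabulate λ k → Data.Bool.if Relation.Nullary.does (k ≟ᶠ i) then 1ℚ else 0ℚ
  where import Data.Bool

-- ω^i: a vector with ω^i u = (π^{-1}_{i}(u))_i for all u ∈ L^{i};
-- written as: for all v ∈ L, ω · π_{i}(v) = v_i  (since π^{-1}(π v) = v)
IsOmega : ∀ {m} → Fin (suc m) → Subset (suc m) → ℚ^ m → Set
IsOmega i L ω = ∀ v → L v → ω · π i v ≡ toℚ (lookup v i)

-- fiber F_{M,b} = { x ∈ ℕ^m : x ≡ b mod M }, as nonnegative integer vectors
Fiber : ∀ {m} → Subset m → ℤ^ m → Subset m
Fiber M b x = (∀ k → ℤ.0ℤ ℤ.≤ lookup x k) × M (x -ᵛ b)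

Edge : ∀ {m} → Subset m → ℤ^ m → ℤ^ m → Set
Edge G x y = G (x -ᵛ y) ⊎ G (y -ᵛ x)

record ReductionPath {m} (φ : ℚ^ m) (M G : Subset m) (b x y : ℤ^ m) : Set where
  field
    k : ℕ
    p : Fin (suc k) → ℤ^ m
    start : p zero ≡ x
    end : p (fromℕ k) ≡ y
    inFiber : ∀ j → Fiber M b (p j)
    edges : ∀ (j : Fin k) → Edge G (p (inject₁ j)) (p (suc j))
    reduction : ∀ (j : Fin (suc k)) → 0 < toℕ j → toℕ j < k →
      ¬ ((φ · p zero ℚ.< φ · p j) × (φ · p (fromℕ k) ℚ.< φ · p j))

IsGroebner : ∀ {m} → ℚ^ m → Subset m → Subset m → Set
IsGroebner φ M G = G ⊆ M ×
  (∀ (b x y : ℤ^ _) → Fiber M b x → Fiber M b y → ReductionPath φ M G b x y)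

_⇔_ : Set → Set → Set
A ⇔ B = (A → B) × (B → A)

{-# OPTIONS --safe #-}
module Submission where

-- On a coset of L, π_{i} is injective and, since ω·π_{i}(v) = v_i for v ∈ L, the linear
-- forms −ω·π_{i} and −eⁱ differ only by a constant, so a path and its image under π_{i} have
-- the same peaks. Hence reduction paths correspond, provided the vertices stay in ℕ^n.
-- Projection preserves this; a lifted path does too, because without an interior −eⁱ-peak
-- every vertex has i-th coordinate at least that of one endpoint. Conversely, two points of
-- a fiber of L^{i} lift into a common fiber of L by choosing the base point with a large
-- enough i-th coordinate.

open import Defs
open import Data.Nat as ℕ using (ℕ; suc; z≤n; s≤s)
import Data.Nat.Properties as ℕP
open import Data.Integer as ℤ using (ℤ; +_; -[1+_]; ∣_∣; 0ℤ)
import Data.Integer.Properties as ℤP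
import Data.Integer.Tactic.RingSolver as ℤSolver
open import Data.Rational as ℚ using (ℚ; 0ℚ; 1ℚ)
import Data.Rational.Properties as ℚP
import Data.Rational.Unnormalised as ℚᵘ
import Data.Rational.Unnormalised.Properties as ℚᵘP
open import Data.Fin using (Fin; toℕ; fromℕ; inject₁; punchIn; punchOut) renaming (zero to fzero; suc to fsuc)
import Data.Fin.Properties as FinP
open import Data.Vec using (Vec; []; _∷_; head; tail; zipWith; lookup; removeAt; insertAt; tabulate)
import Data.Vec.Properties as VecP
open import Data.Product using (∃; ∃₂; _×_; _,_; proj₁; proj₂)
open import Data.Sum using (_⊎_; inj₁; inj₂)
open import Relation.Binary.PropositionalEquality
open import Relation.Nullary using (¬_; yes; no)
open import Relation.Nullary.Decidable using (dec⇒maybe)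
open import Tactic.RingSolver using (solve-∀)
open import Tactic.RingSolver.Core.AlmostCommutativeRing using (AlmostCommutativeRing; fromCommutativeRing)

removeAt-zipWith : ∀ {a b c} {A : Set a} {B : Set b} {C : Set c} {n} (f : A → B → C)
  (xs : Vec A (suc n)) (ys : Vec B (suc n)) (i : Fin (suc n)) →
  removeAt (zipWith f xs ys) i ≡ zipWith f (removeAt xs i) (removeAt ys i)
removeAt-zipWith f (x ∷ xs) (y ∷ ys) fzero = refl
removeAt-zipWith f (x ∷ xs@(_ ∷ _)) (y ∷ ys@(_ ∷ _)) (fsuc i) =
  cong (f x y ∷_) (removeAt-zipWith f xs ys i)

lookup-removeAt : ∀ {a} {A : Set a} {n} (xs : Vec A (suc n)) (i : Fin (suc n)) (k : Fin n) →
  lookup (removeAt xs i) k ≡ lookup xs (punchIn i k)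
lookup-removeAt xs i k = begin
  lookup (removeAt xs i) k
    ≡⟨ VecP.insertAt-punchIn (removeAt xs i) i (lookup xs i) k ⟨
  lookup (insertAt (removeAt xs i) i (lookup xs i)) (punchIn i k)
    ≡⟨ cong (λ ys → lookup ys (punchIn i k)) (VecP.insertAt-removeAt xs i) ⟩
  lookup xs (punchIn i k)
    ∎
  where open ≡-Reasoning

x+y-x≡y : ∀ {n} (x y : ℤ^ n) → (x +ᵛ y) -ᵛ x ≡ y
x+y-x≡y [] [] = refl
x+y-x≡y (a ∷ x) (b ∷ y) = cong₂ _∷_ (identity a b) (x+y-x≡y x y)
  where identity : ∀ a b → (a ℤ.+ b) ℤ.- a ≡ b
        identity = ℤSolver.solve-∀

x+[y-x]≡y : ∀ {n} (x y : ℤ^ n) → x +ᵛ (y -ᵛ x) ≡ y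
x+[y-x]≡y [] [] = refl
x+[y-x]≡y (a ∷ x) (b ∷ y) = cong₂ _∷_ (identity a b) (x+[y-x]≡y x y)
  where identity : ∀ a b → a ℤ.+ (b ℤ.- a) ≡ b
        identity = ℤSolver.solve-∀

[x-z]-[y-z]≡x-y : ∀ {n} (x y z : ℤ^ n) → (x -ᵛ z) -ᵛ (y -ᵛ z) ≡ x -ᵛ y
[x-z]-[y-z]≡x-y [] [] [] = refl
[x-z]-[y-z]≡x-y (a ∷ x) (b ∷ y) (c ∷ z) = cong₂ _∷_ (identity a b c) ([x-z]-[y-z]≡x-y x y z)
  where identity : ∀ a b c → (a ℤ.- c) ℤ.- (b ℤ.- c) ≡ a ℤ.- b
        identity = ℤSolver.solve-∀

x-x≡0 : ∀ {n} (x : ℤ^ n) → x -ᵛ x ≡ zeroV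
x-x≡0 [] = refl
x-x≡0 (a ∷ x) = cong₂ _∷_ (ℤP.+-inverseʳ a) (x-x≡0 x)

x-y≡0⇒x≡y : ∀ {n} (x y : ℤ^ n) → x -ᵛ y ≡ zeroV → x ≡ y
x-y≡0⇒x≡y [] [] _ = refl
x-y≡0⇒x≡y (a ∷ x) (b ∷ y) eq =
  cong₂ _∷_ (ℤP.i-j≡0⇒i≡j a b (cong head eq)) (x-y≡0⇒x≡y x y (cong tail eq))

x-y≡x+[-y] : ∀ {n} (x y : ℤ^ n) → x -ᵛ y ≡ x +ᵛ (-ᵛ y)
x-y≡x+[-y] x y = sym (VecP.zipWith-map₂ ℤ._+_ ℤ.-_ x y)

NonNeg : ∀ {n} → ℤ^ n → Set
NonNeg x = ∀ k → 0ℤ ℤ.≤ lookup x k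

NonNeg-π : ∀ {n} (i : Fin (suc n)) (x : ℤ^ (suc n)) → NonNeg x → NonNeg (π i x)
NonNeg-π i x x≥0 k = subst (0ℤ ℤ.≤_) (sym (lookup-removeAt x i k)) (x≥0 (punchIn i k))

NonNeg-fromπ : ∀ {n} (i : Fin (suc n)) (x : ℤ^ (suc n)) →
  NonNeg (π i x) → 0ℤ ℤ.≤ lookup x i → NonNeg x
NonNeg-fromπ i x πx≥0 xᵢ≥0 k with i FinP.≟ k
... | yes refl = xᵢ≥0
... | no i≢k = subst (0ℤ ℤ.≤_) (VecP.removeAt-punchOut x i≢k) (πx≥0 (punchOut i≢k))

∣i∣≤n⇒0≤n+i : ∀ i n → ∣ i ∣ ℕ.≤ n → 0ℤ ℤ.≤ + n ℤ.+ i
∣i∣≤n⇒0≤n+i (+ _) n _ = ℤ.+≤+ z≤n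
∣i∣≤n⇒0≤n+i -[1+ _ ] n ∣i∣≤n = subst (0ℤ ℤ.≤_) (sym (ℤP.⊖-≥ ∣i∣≤n)) (ℤ.+≤+ z≤n)

toℚᵘ-toℚ : ∀ z → ℚ.toℚᵘ (toℚ z) ℚᵘ.≃ ℚᵘ.mkℚᵘ z 0
toℚᵘ-toℚ z = ℚP.toℚᵘ-fromℚᵘ (ℚᵘ.mkℚᵘ z 0)

toℚ-sub : ∀ a b → toℚ (a ℤ.- b) ≡ toℚ a ℚ.- toℚ b
toℚ-sub a b = ℚP.toℚᵘ-injective (begin
  ℚ.toℚᵘ (toℚ (a ℤ.- b))                  ≈⟨ toℚᵘ-toℚ (a ℤ.- b) ⟩
  ℚᵘ.mkℚᵘ (a ℤ.- b) 0                      ≈⟨ ℚᵘ.*≡* (identity a b) ⟩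
  ℚᵘ.mkℚᵘ a 0 ℚᵘ.- ℚᵘ.mkℚᵘ b 0             ≈⟨ ℚᵘP.+-cong (toℚᵘ-toℚ a) (ℚᵘP.-‿cong (toℚᵘ-toℚ b)) ⟨
  ℚ.toℚᵘ (toℚ a) ℚᵘ.- ℚ.toℚᵘ (toℚ b)       ≈⟨ ℚᵘP.+-congʳ (ℚ.toℚᵘ (toℚ a)) (ℚP.toℚᵘ-homo‿- (toℚ b)) ⟨
  ℚ.toℚᵘ (toℚ a) ℚᵘ.+ ℚ.toℚᵘ (ℚ.- toℚ b)   ≈⟨ ℚP.toℚᵘ-homo-+ (toℚ a) (ℚ.- toℚ b) ⟨
  ℚ.toℚᵘ (toℚ a ℚ.- toℚ b)                 ∎)
  where
  open ℚᵘP.≃-Reasoning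
  identity : ∀ a b → (a ℤ.- b) ℤ.* + 1 ≡ (a ℤ.* + 1 ℤ.+ (ℤ.- b) ℤ.* + 1) ℤ.* + 1
  identity = ℤSolver.solve-∀

toℚ-mono-< : ∀ {a b} → a ℤ.< b → toℚ a ℚ.< toℚ b
toℚ-mono-< {a} {b} a<b = ℚP.toℚᵘ-cancel-<
  (ℚᵘP.<-respˡ-≃ (ℚᵘP.≃-sym (toℚᵘ-toℚ a)) (ℚᵘP.<-respʳ-≃ (ℚᵘP.≃-sym (toℚᵘ-toℚ b))
    (ℚᵘ.*<* (subst₂ ℤ._<_ (sym (ℤP.*-identityʳ a)) (sym (ℤP.*-identityʳ b)) a<b))))

-- The solver only cancels terms with a genuine zero test; (λ _ → nothing) is not enough.
ℚ-ring : AlmostCommutativeRing _ _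
ℚ-ring = fromCommutativeRing ℚP.+-*-commutativeRing (λ x → dec⇒maybe (0ℚ ℚP.≟ x))

negQ-· : ∀ {n} (φ : ℚ^ n) (x : ℤ^ n) → negQ φ · x ≡ ℚ.- (φ · x)
negQ-· [] [] = refl
negQ-· (a ∷ φ) (z ∷ x) = trans (cong (ℚ.- a ℚ.* toℚ z ℚ.+_) (negQ-· φ x)) (identity a (toℚ z) (φ · x))
  where identity : ∀ a t r → ℚ.- a ℚ.* t ℚ.+ ℚ.- r ≡ ℚ.- (a ℚ.* t ℚ.+ r)
        identity = solve-∀ ℚ-ring

·-sub : ∀ {n} (φ : ℚ^ n) (x y : ℤ^ n) → φ · (x -ᵛ y) ≡ φ · x ℚ.- φ · y
·-sub [] [] [] = refl
·-sub (a ∷ φ) (z ∷ x) (w ∷ y) =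
  trans (cong₂ (λ s t → a ℚ.* s ℚ.+ t) (toℚ-sub z w) (·-sub φ x y))
        (identity a (toℚ z) (toℚ w) (φ · x) (φ · y))
  where identity : ∀ a c d e f → a ℚ.* (c ℚ.- d) ℚ.+ (e ℚ.- f) ≡ (a ℚ.* c ℚ.+ e) ℚ.- (a ℚ.* d ℚ.+ f)
        identity = solve-∀ ℚ-ring

·-zeroˡ : ∀ {n} (x : ℤ^ n) → tabulate {n = n} (λ _ → 0ℚ) · x ≡ 0ℚ
·-zeroˡ [] = refl
·-zeroˡ (z ∷ x) = cong₂ ℚ._+_ (ℚP.*-zeroˡ (toℚ z)) (·-zeroˡ x)

unitQ-· : ∀ {n} (i : Fin n) (x : ℤ^ n) → unitQ i · x ≡ toℚ (lookup x i)
unitQ-· fzero (z ∷ x) = begin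
  1ℚ ℚ.* toℚ z ℚ.+ tabulate (λ _ → 0ℚ) · x  ≡⟨ cong (1ℚ ℚ.* toℚ z ℚ.+_) (·-zeroˡ x) ⟩
  1ℚ ℚ.* toℚ z ℚ.+ 0ℚ                       ≡⟨ ℚP.+-identityʳ _ ⟩
  1ℚ ℚ.* toℚ z                              ≡⟨ ℚP.*-identityˡ _ ⟩
  toℚ z                                     ∎
  where open ≡-Reasoning
unitQ-· (fsuc i) (z ∷ x) = begin
  0ℚ ℚ.* toℚ z ℚ.+ unitQ i · x  ≡⟨ cong (ℚ._+ unitQ i · x) (ℚP.*-zeroˡ (toℚ z)) ⟩
  0ℚ ℚ.+ unitQ i · x            ≡⟨ ℚP.+-identityˡ _ ⟩
  unitQ i · x                   ≡⟨ unitQ-· i x ⟩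
  toℚ (lookup x i)              ∎
  where open ≡-Reasoning

≮-negQ-unitQ⇒≤ : ∀ {n} (i : Fin n) (x y : ℤ^ n) →
  ¬ (negQ (unitQ i) · x ℚ.< negQ (unitQ i) · y) → lookup x i ℤ.≤ lookup y i
≮-negQ-unitQ⇒≤ i x y ≮ = ℤP.≮⇒≥ λ yᵢ<xᵢ →
  ≮ (subst₂ ℚ._<_ (negUnit-· x) (negUnit-· y) (ℚP.neg-antimono-< (toℚ-mono-< yᵢ<xᵢ)))
  where negUnit-· : ∀ z → ℚ.- toℚ (lookup z i) ≡ negQ (unitQ i) · z
        negUnit-· z = sym (trans (negQ-· (unitQ i) z) (cong ℚ.-_ (unitQ-· i z)))

<-resp-difference : ∀ {a b c d : ℚ} → a ℚ.- b ≡ c ℚ.- d → a ℚ.< b → c ℚ.< d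
<-resp-difference {a} {b} {c} {d} eq a<b = begin-strict
  c                ≡⟨ identity₁ a c ⟩
  a ℚ.+ (c ℚ.- a)  <⟨ ℚP.+-monoˡ-< (c ℚ.- a) a<b ⟩
  b ℚ.+ (c ℚ.- a)  ≡⟨ identity₂ a b c ⟩
  c ℚ.- (a ℚ.- b)  ≡⟨ cong (λ t → c ℚ.- t) eq ⟩
  c ℚ.- (c ℚ.- d)  ≡⟨ identity₃ c d ⟩
  d                ∎
  where
  open ℚP.≤-Reasoning
  identity₁ : ∀ a c → c ≡ a ℚ.+ (c ℚ.- a)
  identity₁ = solve-∀ ℚ-ring
  identity₂ : ∀ a b c → b ℚ.+ (c ℚ.- a) ≡ c ℚ.- (a ℚ.- b)
  identity₂ = solve-∀ ℚ-ring
  identity₃ : ∀ c d → c ℚ.- (c ℚ.- d) ≡ d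
  identity₃ = solve-∀ ℚ-ring

NoInteriorPeak : ∀ k → (Fin (suc k) → ℚ) → Set
NoInteriorPeak k f = ∀ j → 0 ℕ.< toℕ j → toℕ j ℕ.< k →
  ¬ (f fzero ℚ.< f j × f (fromℕ k) ℚ.< f j)

NoInteriorPeak-resp-differences : ∀ {k} {f g : Fin (suc k) → ℚ} →
  (∀ a c → f a ℚ.- f c ≡ g a ℚ.- g c) → NoInteriorPeak k f → NoInteriorPeak k g
NoInteriorPeak-resp-differences {k} Δ noPeak j 0<j j<k (g₀<gⱼ , gₖ<gⱼ) =
  noPeak j 0<j j<k ( <-resp-difference (sym (Δ fzero j)) g₀<gⱼ
                   , <-resp-difference (sym (Δ (fromℕ k) j)) gₖ<gⱼ)

fromℕ-or-< : ∀ {k} (j : Fin (suc k)) → j ≡ fromℕ k ⊎ toℕ j ℕ.< k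
fromℕ-or-< {k} j with toℕ j ℕ.≟ k
... | yes j≡k = inj₁ (FinP.toℕ-injective (trans j≡k (sym (FinP.toℕ-fromℕ k))))
... | no j≢k = inj₂ (ℕP.≤∧≢⇒< (FinP.toℕ≤pred[n] j) j≢k)

NoInteriorPeak⇒≮-endpoint : ∀ {k} {f : Fin (suc k) → ℚ} → NoInteriorPeak k f →
  ∀ j → ¬ (f fzero ℚ.< f j) ⊎ ¬ (f (fromℕ k) ℚ.< f j)
NoInteriorPeak⇒≮-endpoint _ fzero = inj₁ (ℚP.<-irrefl refl)
NoInteriorPeak⇒≮-endpoint {k} {f} noPeak (fsuc j) with fromℕ-or-< (fsuc j)
... | inj₁ j≡k = inj₂ (subst (λ t → ¬ (f t ℚ.< f (fsuc j))) j≡k (ℚP.<-irrefl refl))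
... | inj₂ j<k with f fzero ℚ.<? f (fsuc j)
...   | no f₀≮fⱼ = inj₁ f₀≮fⱼ
...   | yes f₀<fⱼ = inj₂ λ fₖ<fⱼ → noPeak (fsuc j) (s≤s z≤n) j<k (f₀<fⱼ , fₖ<fⱼ)

NoInteriorPeak-negQ-unitQ⇒lookup-≥0 : ∀ {n k} (i : Fin n) (p : Fin (suc k) → ℤ^ n) →
  NoInteriorPeak k (λ j → negQ (unitQ i) · p j) →
  0ℤ ℤ.≤ lookup (p fzero) i → 0ℤ ℤ.≤ lookup (p (fromℕ k)) i → ∀ j → 0ℤ ℤ.≤ lookup (p j) i
NoInteriorPeak-negQ-unitQ⇒lookup-≥0 {k = k} i p noPeak p₀≥0 pₖ≥0 j
  with NoInteriorPeak⇒≮-endpoint noPeak j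
... | inj₁ ≮₀ = ℤP.≤-trans p₀≥0 (≮-negQ-unitQ⇒≤ i (p fzero) (p j) ≮₀)
... | inj₂ ≮ₖ = ℤP.≤-trans pₖ≥0 (≮-negQ-unitQ⇒≤ i (p (fromℕ k)) (p j) ≮ₖ)

rebase : ∀ {m} {φ : ℚ^ m} {M G : Subset m} {b b′ x x′ y y′ : ℤ^ m} →
  b ≡ b′ → x ≡ x′ → y ≡ y′ → ReductionPath φ M G b x y → ReductionPath φ M G b′ x′ y′
rebase refl refl refl R = R

module LatticeProjection {m} {L : Subset (suc m)} (isL : IsLattice L) (i : Fin (suc m)) where
  open IsLattice isL

  -ᵛ-closed : ∀ {x y} → L x → L y → L (x -ᵛ y)
  -ᵛ-closed {x} {y} x∈ y∈ = subst L (sym (x-y≡x+[-y] x y)) (+-closed x (-ᵛ y) x∈ (neg-closed y y∈))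

  sameCoset : ∀ {b x y} → L (x -ᵛ b) → L (y -ᵛ b) → L (x -ᵛ y)
  sameCoset {b} {x} {y} x∈ y∈ = subst L ([x-z]-[y-z]≡x-y x y b) (-ᵛ-closed x∈ y∈)

  π-fiber : ∀ {b x} → Fiber L b x → Fiber (proj i L) (π i b) (π i x)
  π-fiber {b} {x} (x≥0 , x∈) = NonNeg-π i x x≥0 , (x -ᵛ b , x∈ , removeAt-zipWith ℤ._-_ x b i)

  lift : ∀ {u} → ℤ^ (suc m) → proj i L u → ℤ^ (suc m)
  lift b (v , _) = b +ᵛ v

  lift-∈ : ∀ b {u} (v : proj i L u) → L (lift b v -ᵛ b)
  lift-∈ b (v , v∈ , _) = subst L (sym (x+y-x≡y b v)) v∈

  π-lift : ∀ b {c u} → π i b ≡ c → (v : proj i L (u -ᵛ c)) → π i (lift b v) ≡ u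
  π-lift b {c} {u} πb≡c (v , _ , πv≡u-c) = begin
    π i (b +ᵛ v)        ≡⟨ removeAt-zipWith ℤ._+_ b v i ⟩
    π i b +ᵛ π i v      ≡⟨ cong₂ _+ᵛ_ πb≡c πv≡u-c ⟩
    c +ᵛ (u -ᵛ c)       ≡⟨ x+[y-x]≡y c u ⟩
    u                   ∎
    where open ≡-Reasoning

  π-edge : ∀ {S : Subset m} {x y} → Edge (preimage i L S) x y → Edge S (π i x) (π i y)
  π-edge {S} {x} {y} (inj₁ (_ , s)) = inj₁ (subst S (removeAt-zipWith ℤ._-_ x y i) s)
  π-edge {S} {x} {y} (inj₂ (_ , s)) = inj₂ (subst S (removeAt-zipWith ℤ._-_ y x i) s)

  preimage-edge : ∀ {S : Subset m} {b x y} → L (x -ᵛ b) → L (y -ᵛ b) →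
    Edge S (π i x) (π i y) → Edge (preimage i L S) x y
  preimage-edge {S} {b} {x} {y} x∈ y∈ (inj₁ s) =
    inj₁ (sameCoset x∈ y∈ , subst S (sym (removeAt-zipWith ℤ._-_ x y i)) s)
  preimage-edge {S} {b} {x} {y} x∈ y∈ (inj₂ s) =
    inj₂ (sameCoset y∈ x∈ , subst S (sym (removeAt-zipWith ℤ._-_ y x i)) s)

  common-lift : ∀ {c u v} → Fiber (proj i L) c u → Fiber (proj i L) c v →
    ∃ λ b → ∃₂ λ x y → π i b ≡ c × π i x ≡ u × π i y ≡ v × Fiber L b x × Fiber L b y
  common-lift {c} {u} {v} (u≥0 , u∈) (v≥0 , v∈) =
    b , lift b u∈ , lift b v∈ , πb≡c , π-lift b πb≡c u∈ , π-lift b πb≡c v∈ ,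
    lift-fiber u≥0 u∈ (ℕP.m≤m+n _ _) , lift-fiber v≥0 v∈ (ℕP.m≤n+m _ _)
    where
    T : ℕ
    T = ∣ lookup (proj₁ u∈) i ∣ ℕ.+ ∣ lookup (proj₁ v∈) i ∣
    b : ℤ^ (suc m)
    b = insertAt c i (+ T)
    πb≡c : π i b ≡ c
    πb≡c = VecP.removeAt-insertAt c i (+ T)
    lift-fiber : ∀ {w} → NonNeg w → (z : proj i L (w -ᵛ c)) → ∣ lookup (proj₁ z) i ∣ ℕ.≤ T →
      Fiber L b (lift b z)
    lift-fiber w≥0 z ∣zᵢ∣≤T =
      NonNeg-fromπ i (lift b z) (subst NonNeg (sym (π-lift b πb≡c z)) w≥0)
        (subst (0ℤ ℤ.≤_) (sym liftᵢ) (∣i∣≤n⇒0≤n+i (lookup (proj₁ z) i) T ∣zᵢ∣≤T)) ,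
      lift-∈ b z
      where
      liftᵢ : lookup (lift b z) i ≡ + T ℤ.+ lookup (proj₁ z) i
      liftᵢ = trans (VecP.lookup-zipWith ℤ._+_ i b (proj₁ z))
                    (cong (ℤ._+ _) (VecP.insertAt-lookup c i (+ T)))

  π-injective : KerTrivial i L → ∀ {x y} → L (x -ᵛ y) → π i x ≡ π i y → x ≡ y
  π-injective ker {x} {y} x-y∈ πx≡πy = x-y≡0⇒x≡y x y (ker (x -ᵛ y) x-y∈ (begin
    π i (x -ᵛ y)       ≡⟨ removeAt-zipWith ℤ._-_ x y i ⟩
    π i x -ᵛ π i y     ≡⟨ cong (_-ᵛ π i y) πx≡πy ⟩
    π i y -ᵛ π i y     ≡⟨ x-x≡0 (π i y) ⟩
    zeroV              ∎))
    where open ≡-Reasoning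

  module _ {ω : ℚ^ m} (isω : IsOmega i L ω) where

    ω-gap : ∀ {x y} → L (x -ᵛ y) →
      negQ ω · π i x ℚ.- negQ ω · π i y ≡ negQ (unitQ i) · x ℚ.- negQ (unitQ i) · y
    ω-gap {x} {y} x-y∈ = begin
      negQ ω · π i x ℚ.- negQ ω · π i y    ≡⟨ ·-sub (negQ ω) (π i x) (π i y) ⟨
      negQ ω · (π i x -ᵛ π i y)            ≡⟨ cong (negQ ω ·_) (removeAt-zipWith ℤ._-_ x y i) ⟨
      negQ ω · π i (x -ᵛ y)                ≡⟨ negQ-· ω (π i (x -ᵛ y)) ⟩
      ℚ.- (ω · π i (x -ᵛ y))               ≡⟨ cong ℚ.-_ (isω (x -ᵛ y) x-y∈) ⟩
      ℚ.- toℚ (lookup (x -ᵛ y) i)          ≡⟨ cong ℚ.-_ (unitQ-· i (x -ᵛ y)) ⟨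
      ℚ.- (unitQ i · (x -ᵛ y))             ≡⟨ negQ-· (unitQ i) (x -ᵛ y) ⟨
      negQ (unitQ i) · (x -ᵛ y)            ≡⟨ ·-sub (negQ (unitQ i)) x y ⟩
      negQ (unitQ i) · x ℚ.- negQ (unitQ i) · y ∎
      where open ≡-Reasoning

    project-path : ∀ {S b x y} → ReductionPath (negQ (unitQ i)) L (preimage i L S) b x y →
      ReductionPath (negQ ω) (proj i L) S (π i b) (π i x) (π i y)
    project-path {S} R = record
      { k = k
      ; p = λ j → π i (p j)
      ; start = cong (π i) start
      ; end = cong (π i) end
      ; inFiber = λ j → π-fiber (inFiber j)
      ; edges = λ j → π-edge {S = S} (edges j)
      ; reduction = NoInteriorPeak-resp-differences
          (λ a c → sym (ω-gap (sameCoset (proj₂ (inFiber a)) (proj₂ (inFiber c))))) reduction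
      }
      where open ReductionPath R

    groebner-project : ∀ {S} → S ⊆ proj i L →
      IsGroebner (negQ (unitQ i)) L (preimage i L S) → IsGroebner (negQ ω) (proj i L) S
    groebner-project S⊆ (_ , path) = S⊆ , λ c u v u∈ v∈ →
      let (b , x , y , πb≡c , πx≡u , πy≡v , x∈ , y∈) = common-lift u∈ v∈
      in rebase πb≡c πx≡u πy≡v (project-path (path b x y x∈ y∈))

    module _ (ker : KerTrivial i L) where

      lift-path : ∀ {S b x y} → Fiber L b x → Fiber L b y →
        ReductionPath (negQ ω) (proj i L) S (π i b) (π i x) (π i y) →
        ReductionPath (negQ (unitQ i)) L (preimage i L S) b x y
      lift-path {S} {b} {x} {y} (x≥0 , x∈) (y≥0 , y∈) R = record
        { k = k
        ; p = p
        ; start = p₀≡x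
        ; end = pₖ≡y
        ; inFiber = λ j → p≥0 j , p∈ j
        ; edges = p-edges
        ; reduction = p-reduction
        }
        where
        open ReductionPath R renaming
          (p to q; start to q₀≡πx; end to qₖ≡πy; inFiber to q∈; edges to q-edges; reduction to q-reduction)
        p : Fin (suc k) → ℤ^ (suc m)
        p j = lift b (proj₂ (q∈ j))
        p∈ : ∀ j → L (p j -ᵛ b)
        p∈ j = lift-∈ b (proj₂ (q∈ j))
        πp : ∀ j → π i (p j) ≡ q j
        πp j = π-lift b refl (proj₂ (q∈ j))
        p₀≡x : p fzero ≡ x
        p₀≡x = π-injective ker (sameCoset (p∈ fzero) x∈) (trans (πp fzero) q₀≡πx)
        pₖ≡y : p (fromℕ k) ≡ y
        pₖ≡y = π-injective ker (sameCoset (p∈ (fromℕ k)) y∈) (trans (πp (fromℕ k)) qₖ≡πy)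
        p-edges : ∀ j → Edge (preimage i L S) (p (inject₁ j)) (p (fsuc j))
        p-edges j = preimage-edge {S = S} (p∈ _) (p∈ _)
          (subst₂ (Edge S) (sym (πp (inject₁ j))) (sym (πp (fsuc j))) (q-edges j))
        p-reduction : NoInteriorPeak k (λ j → negQ (unitQ i) · p j)
        p-reduction = NoInteriorPeak-resp-differences Δ q-reduction
          where
          Δ : ∀ a c → negQ ω · q a ℚ.- negQ ω · q c ≡ negQ (unitQ i) · p a ℚ.- negQ (unitQ i) · p c
          Δ a c = subst₂ (λ s t → negQ ω · s ℚ.- negQ ω · t ≡ _) (πp a) (πp c)
            (ω-gap (sameCoset (p∈ a) (p∈ c)))
        p≥0 : ∀ j → NonNeg (p j)
        p≥0 j = NonNeg-fromπ i (p j) (subst NonNeg (sym (πp j)) (proj₁ (q∈ j)))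
          (NoInteriorPeak-negQ-unitQ⇒lookup-≥0 i p p-reduction
            (subst (λ z → 0ℤ ℤ.≤ lookup z i) (sym p₀≡x) (x≥0 i))
            (subst (λ z → 0ℤ ℤ.≤ lookup z i) (sym pₖ≡y) (y≥0 i)) j)

      groebner-lift : ∀ {S} → IsGroebner (negQ ω) (proj i L) S →
        IsGroebner (negQ (unitQ i)) L (preimage i L S)
      groebner-lift (_ , path) = (λ _ → proj₁) , λ b x y x∈ y∈ →
        lift-path x∈ y∈ (path (π i b) (π i x) (π i y) (π-fiber x∈) (π-fiber y∈))

open LatticeProjection

lemma14 : (m : ℕ) (L : Subset (suc m)) → IsLattice L →
    (i : Fin (suc m)) → KerTrivial i L →
    (ω : ℚ^ m) → IsOmega i L ω →
    (S : Subset m) → S ⊆ proj i L →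
    IsGroebner (negQ ω) (proj i L) S ⇔ IsGroebner (negQ (unitQ i)) L (preimage i L S)
lemma14 m L isL i ker ω isω S S⊆ = groebner-lift isL i isω ker , groebner-project isL i isω S⊆
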